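{- The map $\delta$ is a bijection from the set of flat non-Dyck words to itself.
   Context: A word is a finite word over the alphabet $\{0,1\}$; $w_i$ denotes its $i$-th letter. A word is flat if it contains at least as many zeros as ones. A word is a Dyck word if its first $k$ letters form a flat word for every $k$; otherwise it is non-Dyck. For a (nonempty) word $w$, $\gamma(w)$ is the word obtained by removing the final letter of $w$ and placing it at the beginning. For a flat non-Dyck word $w$, $\delta(w)$ is defined as follows: let $w'=\gamma(w)$. If $w'$ is non-Dyck, then $\delta(w)=w'$. Otherwise, let $k$ be the smallest positive integer such that the first $k$ letters of $w'$ contain the same number of ones and zeros (such $k$ exists, $w'_1=0$ and $w'_k=1$); then $\delta(w)$ is obtained from $w'$ by swapping its first and $k$-th letters. ($\delta(w)$ is again a flat non-Dyck word with the same length and the same numbers of zeros and ones as $w$.) -}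

module Defs where

open import Data.Bool using (Bool; true; false)
open import Data.List using (List; []; _∷_; take; length)
open import Data.Nat using (ℕ; zero; suc; _≤_; _≤?_)
open import Data.Fin using (Fin; toℕ)
open import Data.Product using (_×_)
open import Data.Fin.Properties using (all?)
open import Relation.Nullary using (Dec; yes; no; ¬_)

-- Letters: false = 0, true = 1.  A word is a List Bool.
Word : Set
Word = List Bool

zeros : Word → ℕ
zeros []           = zero
zeros (false ∷ w)  = suc (zeros w)
zeros (true ∷ w)   = zeros w

ones : Word → ℕ
ones []           = zero
ones (false ∷ w)  = ones w
ones (true ∷ w)   = suc (ones w)

Flat : Word → Set
Flat w = ones w ≤ zeros w

Dyck : Word → Set
Dyck w = (k : Fin (suc (length w))) → Flat (take (toℕ k) w)

NonDyck : Word → Set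
NonDyck w = ¬ Dyck w

FlatNonDyck : Word → Set
FlatNonDyck w = Flat w × NonDyck w

dyck? : (w : Word) → Dec (Dyck w)
dyck? w = all? (λ k → ones (take (toℕ k) w) ≤? zeros (take (toℕ k) w))

-- γ: remove the final letter and put it at the beginning
γ : Word → Word
γ []          = []
γ (x ∷ [])    = x ∷ []
γ (x ∷ y ∷ w) with γ (y ∷ w)
... | []      = x ∷ []            -- impossible case
... | z ∷ u   = z ∷ x ∷ u

-- Given the remainder after a first letter 0, with current balance
-- (#zeros − #ones of the prefix read so far) equal to (suc c), replace
-- the letter at the first position where the balance returns to 0
-- (necessarily a 1) by 0, leaving everything else unchanged.
fixReturn : ℕ → Word → Word
fixReturn c       []           = []
fixReturn c       (false ∷ w)  = false ∷ fixReturn (suc c) w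
fixReturn zero    (true ∷ w)   = false ∷ w
fixReturn (suc c) (true ∷ w)   = true ∷ fixReturn c w

-- Swap the first letter with the k-th letter, where k is the smallest
-- positive index such that the first k letters contain equally many
-- zeros and ones (applied only when the first letter is 0, so the
-- k-th letter is 1).
swapFirstReturn : Word → Word
swapFirstReturn []          = []
swapFirstReturn (true ∷ w)  = true ∷ w      -- not used for Dyck words
swapFirstReturn (false ∷ w) = true ∷ fixReturn zero w

δ : Word → Word
δ w with dyck? (γ w)
... | no  _ = γ w
... | yes _ = swapFirstReturn (γ w)

module Submission where

-- Read a word as a lattice path: a 0 is an up step, a 1 a down step.
--
-- Write a nonempty word as s ∷ʳ x, so that γ (s ∷ʳ x) = x ∷ s.  Either
-- x ∷ s is non-Dyck and δ just rotates, or x = 0, x ∷ s is Dyck, and δ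
-- produces 1 ∷ fixReturn 0 s, where fixReturn turns the first return of s
-- (started at height 1) to height 0 into an up step.  That step is
-- recovered as the last up step of the result leaving height 0, which is
-- what unfixReturn undoes.

open import Defs
open import Data.Bool using (Bool; true; false)
open import Data.Bool.Properties using (not-¬; ¬-not)
open import Data.Empty using (⊥-elim)
open import Data.Fin using (Fin; toℕ) renaming (zero to fzero; suc to fsuc)
open import Data.List using ([]; _∷_; _++_; _∷ʳ_; take; length; initLast; _∷ʳ′_)
open import Data.Nat using (ℕ; zero; suc; _≤_; _+_; z≤n; s≤s; s≤s⁻¹)
open import Data.Nat.Properties using (+-suc)
open import Data.Product using (_×_; Σ; _,_; proj₁; proj₂)
open import Relation.Nullary using (yes; no)
open import Relation.Binary.PropositionalEquality
  using (_≡_; refl; sym; cong; subst; subst₂; module ≡-Reasoning)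

nonnegFrom : ℕ → Word → Bool
nonnegFrom c       []          = true
nonnegFrom c       (false ∷ w) = nonnegFrom (suc c) w
nonnegFrom zero    (true ∷ w)  = false
nonnegFrom (suc c) (true ∷ w)  = nonnegFrom c w

-- Started at height c, the path of r touches height 0 (trivially so when
-- c = 0): a down step followed by r takes the path below 0.
ReachesZero : ℕ → Word → Set
ReachesZero c r = nonnegFrom c (true ∷ r) ≡ false

nonnegFrom-sound : ∀ c w → nonnegFrom c w ≡ true → (k : Fin (suc (length w))) →
                   ones (take (toℕ k) w) ≤ c + zeros (take (toℕ k) w)
nonnegFrom-sound c       w           h  fzero    = z≤n
nonnegFrom-sound c       (false ∷ w) h  (fsuc k) =
  subst (ones (take (toℕ k) w) ≤_) (sym (+-suc c _)) (nonnegFrom-sound (suc c) w h k)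
nonnegFrom-sound zero    (true ∷ w)  () (fsuc k)
nonnegFrom-sound (suc c) (true ∷ w)  h  (fsuc k) = s≤s (nonnegFrom-sound c w h k)

nonnegFrom-complete : ∀ c w → ((k : Fin (suc (length w))) →
                      ones (take (toℕ k) w) ≤ c + zeros (take (toℕ k) w)) →
                      nonnegFrom c w ≡ true
nonnegFrom-complete c       []          bound = refl
nonnegFrom-complete c       (false ∷ w) bound = nonnegFrom-complete (suc c) w
  (λ k → subst (ones (take (toℕ k) w) ≤_) (+-suc c _) (bound (fsuc k)))
nonnegFrom-complete zero    (true ∷ w)  bound with bound (fsuc fzero)
... | ()
nonnegFrom-complete (suc c) (true ∷ w)  bound =
  nonnegFrom-complete c w (λ k → s≤s⁻¹ (bound (fsuc k)))

true⇒dyck : ∀ {w} → nonnegFrom 0 w ≡ true → Dyck w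
true⇒dyck {w} = nonnegFrom-sound 0 w

dyck⇒true : ∀ {w} → Dyck w → nonnegFrom 0 w ≡ true
dyck⇒true {w} = nonnegFrom-complete 0 w

false⇒nonDyck : ∀ {w} → nonnegFrom 0 w ≡ false → NonDyck w
false⇒nonDyck h d = not-¬ h (dyck⇒true d)

nonDyck⇒false : ∀ {w} → NonDyck w → nonnegFrom 0 w ≡ false
nonDyck⇒false nd = ¬-not (λ h → nd (true⇒dyck h))

startsWithOne-nonDyck : ∀ w → NonDyck (true ∷ w)
startsWithOne-nonDyck w = false⇒nonDyck refl

nonnegFrom-raise : ∀ c s → nonnegFrom c s ≡ true → nonnegFrom (suc c) s ≡ true
nonnegFrom-raise c       []          h  = refl
nonnegFrom-raise c       (false ∷ s) h  = nonnegFrom-raise (suc c) s h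
nonnegFrom-raise zero    (true ∷ s)  ()
nonnegFrom-raise (suc c) (true ∷ s)  h  = nonnegFrom-raise c s h

nonnegFrom-prefix : ∀ c s t → nonnegFrom c (s ++ t) ≡ true → nonnegFrom c s ≡ true
nonnegFrom-prefix c       []          t h  = refl
nonnegFrom-prefix c       (false ∷ s) t h  = nonnegFrom-prefix (suc c) s t h
nonnegFrom-prefix zero    (true ∷ s)  t ()
nonnegFrom-prefix (suc c) (true ∷ s)  t h  = nonnegFrom-prefix c s t h

nonnegFrom-snocUp : ∀ c s → nonnegFrom c s ≡ true → nonnegFrom c (s ∷ʳ false) ≡ true
nonnegFrom-snocUp c       []          h  = refl
nonnegFrom-snocUp c       (false ∷ s) h  = nonnegFrom-snocUp (suc c) s h
nonnegFrom-snocUp zero    (true ∷ s)  ()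
nonnegFrom-snocUp (suc c) (true ∷ s)  h  = nonnegFrom-snocUp c s h

nonnegFrom-snocDown : ∀ c s → nonnegFrom c s ≡ true → nonnegFrom (suc c) (s ∷ʳ true) ≡ true
nonnegFrom-snocDown c       []          h  = refl
nonnegFrom-snocDown c       (false ∷ s) h  = nonnegFrom-snocDown (suc c) s h
nonnegFrom-snocDown zero    (true ∷ s)  ()
nonnegFrom-snocDown (suc c) (true ∷ s)  h  = nonnegFrom-snocDown c s h

nonnegFrom-unsnocUp : ∀ c s → nonnegFrom c (s ∷ʳ false) ≡ false → nonnegFrom c s ≡ false
nonnegFrom-unsnocUp c s h = ¬-not (λ nonneg → not-¬ h (nonnegFrom-snocUp c s nonneg))

γ-snoc : ∀ s x → γ (s ∷ʳ x) ≡ x ∷ s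
γ-snoc []          x = refl
γ-snoc (y ∷ [])    x = refl
γ-snoc (y ∷ z ∷ s) x rewrite γ-snoc (z ∷ s) x = refl

zeros-rotate : ∀ s x → zeros (s ∷ʳ x) ≡ zeros (x ∷ s)
zeros-rotate []          x     = refl
zeros-rotate (false ∷ s) false = cong suc (zeros-rotate s false)
zeros-rotate (false ∷ s) true  = cong suc (zeros-rotate s true)
zeros-rotate (true ∷ s)  false = zeros-rotate s false
zeros-rotate (true ∷ s)  true  = zeros-rotate s true

ones-rotate : ∀ s x → ones (s ∷ʳ x) ≡ ones (x ∷ s)
ones-rotate []          x     = refl
ones-rotate (true ∷ s)  false = cong suc (ones-rotate s false)
ones-rotate (true ∷ s)  true  = cong suc (ones-rotate s true)
ones-rotate (false ∷ s) false = ones-rotate s false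
ones-rotate (false ∷ s) true  = ones-rotate s true

flat-rotate : ∀ s x → Flat (s ∷ʳ x) → Flat (x ∷ s)
flat-rotate s x = subst₂ _≤_ (ones-rotate s x) (zeros-rotate s x)

flat-unrotate : ∀ s x → Flat (x ∷ s) → Flat (s ∷ʳ x)
flat-unrotate s x = subst₂ _≤_ (sym (ones-rotate s x)) (sym (zeros-rotate s x))

-- The first return.  fixReturn c s reads s as a path from height suc c; if
-- that path reaches 0, exactly one 1 (the step into height 0) becomes a 0.
fixReturn-zeros : ∀ c s → ReachesZero (suc c) s → zeros (fixReturn c s) ≡ suc (zeros s)
fixReturn-zeros c       []          ()
fixReturn-zeros c       (false ∷ s) h = cong suc (fixReturn-zeros (suc c) s h)
fixReturn-zeros zero    (true ∷ s)  h = refl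
fixReturn-zeros (suc c) (true ∷ s)  h = fixReturn-zeros c s h

fixReturn-ones : ∀ c s → ReachesZero (suc c) s → suc (ones (fixReturn c s)) ≡ ones s
fixReturn-ones c       []          ()
fixReturn-ones c       (false ∷ s) h = fixReturn-ones (suc c) s h
fixReturn-ones zero    (true ∷ s)  h = refl
fixReturn-ones (suc c) (true ∷ s)  h = cong suc (fixReturn-ones c s h)

-- Before the flipped step the path is unchanged, and just before it the
-- path (from suc c) is at height 1; so from height c it already touches 0.
fixReturn-reachesZero : ∀ c s → ReachesZero (suc c) s → ReachesZero c (fixReturn c s)
fixReturn-reachesZero zero    s           h  = refl
fixReturn-reachesZero (suc c) []          ()
fixReturn-reachesZero (suc c) (false ∷ s) h  = fixReturn-reachesZero (suc (suc c)) s h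
fixReturn-reachesZero (suc c) (true ∷ s)  h  = fixReturn-reachesZero c s h

-- If s, started at suc c, first touches 0 and never goes below it, then
-- after the flip the path from c stays nonnegative even followed by a
-- final down step: it ends at height 1 or more.
fixReturn-snocDown : ∀ c s → nonnegFrom (suc c) s ≡ true → ReachesZero (suc c) s →
                     nonnegFrom c (fixReturn c s ∷ʳ true) ≡ true
fixReturn-snocDown c       []          _      ()
fixReturn-snocDown c       (false ∷ s) nonneg h = fixReturn-snocDown (suc c) s nonneg h
fixReturn-snocDown zero    (true ∷ s)  nonneg h = nonnegFrom-snocDown 0 s nonneg
fixReturn-snocDown (suc c) (true ∷ s)  nonneg h = fixReturn-snocDown c s nonneg h

-- Undoing the flip: reading r from height c, the flipped step is the up
-- step leaving height 0 after which the path never comes back to 0.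
unfixReturn : ℕ → Word → Word
unfixReturn c       []          = []
unfixReturn zero    (false ∷ s) with nonnegFrom 0 s
... | true  = true ∷ s
... | false = false ∷ unfixReturn 1 s
unfixReturn (suc c) (false ∷ s) = false ∷ unfixReturn (suc (suc c)) s
unfixReturn zero    (true ∷ s)  = true ∷ s
unfixReturn (suc c) (true ∷ s)  = true ∷ unfixReturn c s

unfixReturn-fixReturn : ∀ c s → nonnegFrom (suc c) s ≡ true → ReachesZero (suc c) s →
                        unfixReturn c (fixReturn c s) ≡ s
unfixReturn-fixReturn c       []          _      ()
unfixReturn-fixReturn zero    (false ∷ s) nonneg h
  rewrite fixReturn-reachesZero 1 s h = cong (false ∷_) (unfixReturn-fixReturn 1 s nonneg h)
unfixReturn-fixReturn (suc c) (false ∷ s) nonneg h =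
  cong (false ∷_) (unfixReturn-fixReturn (suc (suc c)) s nonneg h)
unfixReturn-fixReturn zero    (true ∷ s)  nonneg h rewrite nonneg = refl
unfixReturn-fixReturn (suc c) (true ∷ s)  nonneg h =
  cong (true ∷_) (unfixReturn-fixReturn c s nonneg h)

fixReturn-unfixReturn : ∀ c r → nonnegFrom c (r ∷ʳ true) ≡ true → ReachesZero c r →
                        fixReturn c (unfixReturn c r) ≡ r
fixReturn-unfixReturn zero    []          ()   _
fixReturn-unfixReturn (suc c) []          _    ()
fixReturn-unfixReturn zero    (false ∷ s) down _ with nonnegFrom 0 s in eq
... | true  = refl
... | false = cong (false ∷_) (fixReturn-unfixReturn 1 s down eq)
fixReturn-unfixReturn (suc c) (false ∷ s) down h =
  cong (false ∷_) (fixReturn-unfixReturn (suc (suc c)) s down h)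
fixReturn-unfixReturn zero    (true ∷ s)  ()   _
fixReturn-unfixReturn (suc c) (true ∷ s)  down h =
  cong (true ∷_) (fixReturn-unfixReturn c s down h)

unfixReturn-nonneg : ∀ c r → nonnegFrom c (r ∷ʳ true) ≡ true → ReachesZero c r →
                     nonnegFrom (suc c) (unfixReturn c r) ≡ true
unfixReturn-nonneg zero    []          ()   _
unfixReturn-nonneg (suc c) []          _    ()
unfixReturn-nonneg zero    (false ∷ s) down _ with nonnegFrom 0 s in eq
... | true  = eq
... | false = unfixReturn-nonneg 1 s down eq
unfixReturn-nonneg (suc c) (false ∷ s) down h = unfixReturn-nonneg (suc (suc c)) s down h
unfixReturn-nonneg zero    (true ∷ s)  ()   _
unfixReturn-nonneg (suc c) (true ∷ s)  down h = unfixReturn-nonneg c s down h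

unfixReturn-snocUp : ∀ c r → nonnegFrom c (r ∷ʳ true) ≡ true → ReachesZero c r →
                     nonnegFrom c (unfixReturn c r ∷ʳ false) ≡ false
unfixReturn-snocUp zero    []          ()   _
unfixReturn-snocUp (suc c) []          _    ()
unfixReturn-snocUp zero    (false ∷ s) down _ with nonnegFrom 0 s in eq
... | true  = refl
... | false = unfixReturn-snocUp 1 s down eq
unfixReturn-snocUp (suc c) (false ∷ s) down h = unfixReturn-snocUp (suc (suc c)) s down h
unfixReturn-snocUp zero    (true ∷ s)  ()   _
unfixReturn-snocUp (suc c) (true ∷ s)  down h = unfixReturn-snocUp c s down h

-- The flip turns a word 0s that is flat into the flat word 1 (fixReturn 0 s)
-- and back: it trades a 1 for a 0, and moving the first letter does the
-- reverse trade.
flat-fixReturn : ∀ s → ReachesZero 1 s → Flat (false ∷ s) → Flat (true ∷ fixReturn 0 s)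
flat-fixReturn s h = subst₂ _≤_ (sym (fixReturn-ones 0 s h)) (sym (fixReturn-zeros 0 s h))

flat-unfixReturn : ∀ s → ReachesZero 1 s → Flat (true ∷ fixReturn 0 s) → Flat (false ∷ s)
flat-unfixReturn s h = subst₂ _≤_ (fixReturn-ones 0 s h) (fixReturn-zeros 0 s h)

δ-rotate : ∀ s x → nonnegFrom 0 (x ∷ s) ≡ false → δ (s ∷ʳ x) ≡ x ∷ s
δ-rotate s x h with dyck? (γ (s ∷ʳ x))
... | yes d = ⊥-elim (false⇒nonDyck h (subst Dyck (γ-snoc s x) d))
... | no _  = γ-snoc s x

δ-flip : ∀ s → nonnegFrom 1 s ≡ true → δ (s ∷ʳ false) ≡ true ∷ fixReturn 0 s
δ-flip s h with dyck? (γ (s ∷ʳ false))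
... | yes _  = cong swapFirstReturn (γ-snoc s false)
... | no nd = ⊥-elim (nd (subst Dyck (sym (γ-snoc s false)) (true⇒dyck h)))

δ⁻¹ : Word → Word
δ⁻¹ []      = []
δ⁻¹ (y ∷ r) with nonnegFrom 0 (r ∷ʳ y)
... | false = r ∷ʳ y
... | true  = unfixReturn 0 r ∷ʳ false

δ⁻¹-rotate : ∀ y r → nonnegFrom 0 (r ∷ʳ y) ≡ false → δ⁻¹ (y ∷ r) ≡ r ∷ʳ y
δ⁻¹-rotate y r h rewrite h = refl

δ⁻¹-flip : ∀ y r → nonnegFrom 0 (r ∷ʳ y) ≡ true → δ⁻¹ (y ∷ r) ≡ unfixReturn 0 r ∷ʳ false
δ⁻¹-flip y r h rewrite h = refl

rotateCase : ∀ s x → nonnegFrom 0 (x ∷ s) ≡ false → FlatNonDyck (s ∷ʳ x) →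
             FlatNonDyck (δ (s ∷ʳ x)) × δ⁻¹ (δ (s ∷ʳ x)) ≡ s ∷ʳ x
rotateCase s x h (flat , nonDyck) rewrite δ-rotate s x h =
  (flat-rotate s x flat , false⇒nonDyck h) , δ⁻¹-rotate x s (nonDyck⇒false nonDyck)

flipCase : ∀ s → nonnegFrom 1 s ≡ true → FlatNonDyck (s ∷ʳ false) →
           FlatNonDyck (δ (s ∷ʳ false)) × δ⁻¹ (δ (s ∷ʳ false)) ≡ s ∷ʳ false
flipCase s nonneg (flat , nonDyck) rewrite δ-flip s nonneg =
  (flat-fixReturn s reaches (flat-rotate s false flat) , startsWithOne-nonDyck _) ,
  (begin
    δ⁻¹ (true ∷ fixReturn 0 s)             ≡⟨ δ⁻¹-flip true (fixReturn 0 s) (fixReturn-snocDown 0 s nonneg reaches) ⟩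
    unfixReturn 0 (fixReturn 0 s) ∷ʳ false ≡⟨ cong (_∷ʳ false) (unfixReturn-fixReturn 0 s nonneg reaches) ⟩
    s ∷ʳ false                             ∎)
  where
  open ≡-Reasoning
  reaches : ReachesZero 1 s
  reaches = nonnegFrom-unsnocUp 0 s (nonDyck⇒false nonDyck)

δ-leftInverse : ∀ w → FlatNonDyck w → FlatNonDyck (δ w) × δ⁻¹ (δ w) ≡ w
δ-leftInverse w fnd with initLast w
... | []            = ⊥-elim (proj₂ fnd (true⇒dyck refl))
... | s ∷ʳ′ true    = rotateCase s true refl fnd
... | s ∷ʳ′ false with nonnegFrom 1 s in eq
...   | false = rotateCase s false eq fnd
...   | true  = flipCase s eq fnd

unflipCase : ∀ r → nonnegFrom 0 (r ∷ʳ true) ≡ true → Flat (true ∷ r) →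
             FlatNonDyck (unfixReturn 0 r ∷ʳ false) × δ (unfixReturn 0 r ∷ʳ false) ≡ true ∷ r
unflipCase r down flat =
  (flat-unrotate t false (flat-unfixReturn t reaches flatFixed) , false⇒nonDyck nonDyck) ,
  (begin
    δ (t ∷ʳ false)         ≡⟨ δ-flip t (unfixReturn-nonneg 0 r down refl) ⟩
    true ∷ fixReturn 0 t   ≡⟨ cong (true ∷_) refixed ⟩
    true ∷ r               ∎)
  where
  open ≡-Reasoning
  t : Word
  t = unfixReturn 0 r
  refixed : fixReturn 0 t ≡ r
  refixed = fixReturn-unfixReturn 0 r down refl
  nonDyck : nonnegFrom 0 (t ∷ʳ false) ≡ false
  nonDyck = unfixReturn-snocUp 0 r down refl
  reaches : ReachesZero 1 t
  reaches = nonnegFrom-unsnocUp 0 t nonDyck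
  flatFixed : Flat (true ∷ fixReturn 0 t)
  flatFixed = subst (λ f → Flat (true ∷ f)) (sym refixed) flat

δ-rightInverse : ∀ v → FlatNonDyck v → FlatNonDyck (δ⁻¹ v) × δ (δ⁻¹ v) ≡ v
δ-rightInverse []      (_ , nonDyck) = ⊥-elim (nonDyck (true⇒dyck refl))
δ-rightInverse (y ∷ r) (flat , nonDyck) with nonnegFrom 0 (r ∷ʳ y) in eq
... | false =
  (flat-unrotate r y flat , false⇒nonDyck eq) , δ-rotate r y (nonDyck⇒false nonDyck)
... | true with y
...   | true  = unflipCase r eq flat
...   | false = ⊥-elim (nonDyck (true⇒dyck upThenR))
  where
  -- r ∷ʳ 0 Dyck forces r Dyck, hence 0 ∷ r Dyck: impossible.
  upThenR : nonnegFrom 0 (false ∷ r) ≡ true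
  upThenR = nonnegFrom-raise 0 r (nonnegFrom-prefix 0 r _ eq)

lemma5p6 : ((w : Word) → FlatNonDyck w → FlatNonDyck (δ w))
         × ((u v : Word) → FlatNonDyck u → FlatNonDyck v → δ u ≡ δ v → u ≡ v)
         × ((v : Word) → FlatNonDyck v → Σ Word (λ u → FlatNonDyck u × δ u ≡ v))
lemma5p6 = preserves , injective , surjective
  where
  open ≡-Reasoning
  preserves : (w : Word) → FlatNonDyck w → FlatNonDyck (δ w)
  preserves w fnd = proj₁ (δ-leftInverse w fnd)
  injective : (u v : Word) → FlatNonDyck u → FlatNonDyck v → δ u ≡ δ v → u ≡ v
  injective u v fu fv δu≡δv with δ-leftInverse u fu | δ-leftInverse v fv
  ... | _ , invU | _ , invV = begin
    u           ≡⟨ sym invU ⟩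
    δ⁻¹ (δ u)   ≡⟨ cong δ⁻¹ δu≡δv ⟩
    δ⁻¹ (δ v)   ≡⟨ invV ⟩
    v           ∎
  surjective : (v : Word) → FlatNonDyck v → Σ Word (λ u → FlatNonDyck u × δ u ≡ v)
  surjective v fv = δ⁻¹ v , δ-rightInverse v fv
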